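{- Let $\mathcal{E}(n)$ (respectively $\mathcal{O}(n)$) denote the number of even (respectively odd) admissible partitions of the positive integer $n$. Then $\mathcal{O}(n) \sim \mathcal{E}(n)$ as $n \to \infty$, i.e. $\lim_{n\to\infty} \mathcal{O}(n)/\mathcal{E}(n) = 1$.
   Context: Let $B$ ("blue") be the set of squarefree positive integers with an even number of prime factors (so $1 \in B$), and $R$ ("red") the set of squarefree positive integers with an odd number of prime factors. A partition of a positive integer $n$ (an unordered representation of $n$ as a sum of positive integers, its parts) is called admissible if every part lies in $B \cup R$ and each element of $R$ appears at most once as a part. An admissible partition is even (respectively odd) if the number of parts belonging to $R$ is even (respectively odd). -}

module Defs where

open import Data.Bool using (Bool; true; false; _∧_; _∨_; not; T)
open import Data.Nat using (ℕ; zero; suc; _+_; _*_; _≤ᵇ_; _≡ᵇ_)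
open import Data.Nat.Divisibility using (_∣?_)
open import Data.Nat.Primality using (prime?)
open import Data.List using (List; []; _∷_; length; upTo; filterᵇ)
open import Data.Nat.ListAction using (sum)
open import Data.Bool.ListAction using (all)
open import Data.Product using (Σ)
open import Relation.Nullary using (does)

evenᵇ : ℕ → Bool
evenᵇ zero = true
evenᵇ (suc n) = not (evenᵇ n)

squarefreeᵇ : ℕ → Bool
squarefreeᵇ m = (1 ≤ᵇ m) ∧ all (λ d → not ((2 ≤ᵇ d) ∧ does (d * d ∣? m))) (upTo (suc m))

-- number of distinct prime divisors of m (= number of prime factors when m is squarefree)
ω : ℕ → ℕ
ω m = length (filterᵇ (λ p → does (prime? p) ∧ does (p ∣? m)) (upTo (suc m)))

-- B (blue): squarefree with an even number of prime factors (1 ∈ B)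
blueᵇ : ℕ → Bool
blueᵇ m = squarefreeᵇ m ∧ evenᵇ (ω m)

redᵇ : ℕ → Bool
redᵇ m = squarefreeᵇ m ∧ not (evenᵇ (ω m))

countᵇ : ℕ → List ℕ → ℕ
countᵇ x l = length (filterᵇ (λ y → x ≡ᵇ y) l)

-- list is weakly decreasing (canonical representation of an unordered partition)
nonincreasingᵇ : List ℕ → Bool
nonincreasingᵇ [] = true
nonincreasingᵇ (x ∷ []) = true
nonincreasingᵇ (x ∷ y ∷ l) = (y ≤ᵇ x) ∧ nonincreasingᵇ (y ∷ l)

admissibleᵇ : ℕ → List ℕ → Bool
admissibleᵇ n l =
  nonincreasingᵇ l ∧ (sum l ≡ᵇ n) ∧ all (λ x → (1 ≤ᵇ x) ∧ (blueᵇ x ∨ redᵇ x)) l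
  ∧ all (λ x → not (redᵇ x) ∨ (countᵇ x l ≤ᵇ 1)) l

redParts : List ℕ → ℕ
redParts l = length (filterᵇ redᵇ l)

EvenAdmissible : ℕ → Set
EvenAdmissible n = Σ (List ℕ) (λ l → T (admissibleᵇ n l ∧ evenᵇ (redParts l)))

OddAdmissible : ℕ → Set
OddAdmissible n = Σ (List ℕ) (λ l → T (admissibleᵇ n l ∧ not (evenᵇ (redParts l))))

module Submission where

-- Exchanging a part 2 (red) for two parts 1 (blue), or back, is a parity-reversing involution
-- on admissible partitions, defined on all of them except the unpaired ones: those with no
-- part 2 and at most one part 1.  Hence |O(n) - E(n)| is at most the number U(n) of unpaired
-- partitions.  An unpaired partition with at least M distinct parts yields M distinct
-- admissible partitions by breaking one of these parts v ≥ 3 into twos and ones (v is their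
-- total, so it can be read off), while one with fewer distinct parts is determined by fewer
-- than 2M numbers ≤ n.  So M·U(n) ≤ E(n) + O(n) + M·(n+1)^(2M).  On the other hand, if
-- b₁ > ... > b_K are blue numbers 2p (p an odd prime) with sum S, every choice of
-- multiplicities below ⌊n/S⌋ gives an even admissible partition, so E(n) ≥ ⌊n/S⌋^K.  With
-- K = 2M+1 the polynomial term is eventually below E(n), leaving M·|O - E| < 3E + |O - E|,
-- and M = 3(k+1)+1 gives (k+1)·|O(n) - E(n)| < E(n).

open import Defs
open import Data.Bool using (Bool; true; false; _∧_; _∨_; not; T; T?)
open import Data.Bool.Properties using (T-∧; T-∨; T-irrelevant; not-involutive)
open import Data.Bool.ListAction using (all)
open import Data.Empty using (⊥-elim)
open import Data.Fin using (Fin; toℕ; inject≤; fromℕ<; remQuot; combine)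
import Data.Fin as Fin
open import Data.Fin.Properties
  using (injective⇒≤; +↔⊎; *↔×; inject≤-injective; toℕ-fromℕ<; toℕ<n; toℕ-injective; combine-remQuot)
open import Data.List using (List; []; _∷_; _++_; length; replicate; filterᵇ; lookup; map; upTo)
open import Data.List.Properties
  using ( length-++; length-replicate; length-map; filter-++; filter-all; filter-none
        ; filter-accept; filter-reject; ++-identityʳ; ∷-injective; upTo-∷ʳ)
open import Data.List.Membership.Propositional using (_∈_)
open import Data.List.Membership.Propositional.Properties using (∈-lookup)
open import Data.List.Relation.Binary.Sublist.Propositional using (_⊆_; []; _∷_; _∷ʳ_; ⊆-refl)
open import Data.List.Relation.Binary.Sublist.Propositional.Properties
  using (All-resp-⊆; filter-⊆; filter⁺; length-mono-≤)
open import Data.List.Relation.Unary.All as All using (All; []; _∷_)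
import Data.List.Relation.Unary.All.Properties as Allₚ
open import Data.List.Relation.Unary.AllPairs as AllPairs using (AllPairs; []; _∷_)
import Data.List.Relation.Unary.AllPairs.Properties as AllPairsₚ
open import Data.List.Relation.Unary.Any using (here; there)
open import Data.List.Relation.Unary.Linked using (Linked; []; [-]; _∷_)
open import Data.List.Relation.Unary.Linked.Properties using (Linked⇒AllPairs; AllPairs⇒Linked)
open import Data.Nat
open import Data.Nat.Properties
open import Data.Nat.DivMod
  using (_%_; _/_; m<n⇒m%n≡m; [m+kn]%n≡m%n; m*n/n≡m; /-monoˡ-≤; m≡m%n+[m/n]*n; m%n<n; m/n*n≤m)
open import Data.Nat.Divisibility
  using (_∣_; _∣?_; ∣-trans; m∣m*n; n∣m*n; *-pres-∣; *-cancelˡ-∣; ∣1⇒≡1; ∣m+n∣m⇒∣n; m≤n⇒m!∣n!)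
open import Data.Nat.ListAction using (sum; product)
open import Data.Nat.ListAction.Properties using (sum-++)
open import Data.Nat.Primality
  using (Prime; prime?; prime[2]; prime⇒nonTrivial; prime⇒nonZero; prime⇒irreducible; ¬prime[1]; euclidsLemma)
open import Data.Nat.Primality.Factorisation using (factorise)
open import Data.Nat.Tactic.RingSolver using (solve-∀)
open import Data.List.Membership.DecPropositional _≟_ using (_∈?_)
open import Data.Product using (Σ; ∃; _×_; _,_; proj₁; proj₂; uncurry)
open import Data.Product.Algebra using (×-distribˡ-⊎)
open import Data.Product.Function.NonDependent.Propositional using (_×-↣_; _×-↔_)
open import Data.Sum using (_⊎_; inj₁; inj₂; [_,_]′)
open import Data.Sum.Function.Propositional using (_⊎-↣_; _⊎-↔_)
open import Data.Unit using (tt)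
open import Function using (_∘_; Injective; _↣_; _↔_; Equivalence; Injection; mk↣)
open import Function.Construct.Composition using (_↣-∘_)
open import Function.Construct.Identity using (↣-id; ↔-id)
open import Function.Properties.Inverse using (↔⇒↣; ↔-sym)
open import Function.Related.Propositional using (module EquationalReasoning; injection)
open import Relation.Binary.PropositionalEquality
open import Relation.Nullary using (¬_; yes; no; does)
open import Relation.Nullary.Decidable using (dec-true)

private
  variable
    A B C : Set
    m n : ℕ
    l xs ys : List ℕ

↣⇒≤ : Fin m ↣ Fin n → m ≤ n
↣⇒≤ f = injective⇒≤ (Injection.injective f)

mk↣-via : ∀ (f : A → B) (g : B → C) {h : A → C} → Injective _≡_ _≡_ h → (∀ x → g (f x) ≡ h x) →
  A ↣ B
mk↣-via f g h-injective g∘f≗h = mk↣ {to = f} λ {x} {y} eq →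
  h-injective (trans (sym (g∘f≗h x)) (trans (cong g eq) (g∘f≗h y)))

proj₁-injective : ∀ {p : A → Bool} → Injective _≡_ _≡_ (proj₁ {B = T ∘ p})
proj₁-injective {x = a , h} {y = .a , h′} refl = cong (a ,_) (T-irrelevant h h′)

T-∧⁺ : ∀ {a b} → T a → T b → T (a ∧ b)
T-∧⁺ p q = Equivalence.from T-∧ (p , q)

T-∧⁻ : ∀ {a b} → T (a ∧ b) → T a × T b
T-∧⁻ = Equivalence.to T-∧

T⇒¬T-not : ∀ {b} → T b → ¬ T (not b)
T⇒¬T-not {true} _ ()

module _ (p q : A → Bool) where

  P∧Q P∧¬Q : Set
  P∧Q  = Σ A λ x → T (p x ∧ q x)
  P∧¬Q = Σ A λ x → T (p x ∧ not (q x))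

  split-↣ : Σ A (T ∘ p) ↣ (P∧Q ⊎ P∧¬Q)
  split-↣ = mk↣-via split forget proj₁-injective λ (x , h) → forget-splitBy x h (q x) refl
    where
    splitBy : ∀ x → T (p x) → (b : Bool) → q x ≡ b → P∧Q ⊎ P∧¬Q
    splitBy x h true  e = inj₁ (x , T-∧⁺ h (subst T (sym e) tt))
    splitBy x h false e = inj₂ (x , T-∧⁺ h (subst (T ∘ not) (sym e) tt))
    split : Σ A (T ∘ p) → P∧Q ⊎ P∧¬Q
    split (x , h) = splitBy x h (q x) refl
    forget : P∧Q ⊎ P∧¬Q → A
    forget (inj₁ (x , _)) = x
    forget (inj₂ (x , _)) = x
    forget-splitBy : ∀ x h b e → forget (splitBy x h b e) ≡ x
    forget-splitBy x h true  e = refl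
    forget-splitBy x h false e = refl

-- Admissible partitions

≢⇒¬T≡ᵇ : ∀ {x y} → x ≢ y → ¬ T (x ≡ᵇ y)
≢⇒¬T≡ᵇ {x} {y} x≢y = x≢y ∘ ≡ᵇ⇒≡ x y

count-++ : ∀ x xs ys → countᵇ x (xs ++ ys) ≡ countᵇ x xs + countᵇ x ys
count-++ x xs ys = trans (cong length (filter-++ _ xs ys)) (length-++ (filterᵇ (x ≡ᵇ_) xs))

count-replicate : ∀ x k → countᵇ x (replicate k x) ≡ k
count-replicate x k =
  trans (cong length (filter-all _ (Allₚ.replicate⁺ k (≡⇒≡ᵇ x x refl)))) (length-replicate k)

count-absent : ∀ x → All (x ≢_) l → countᵇ x l ≡ 0
count-absent x x∉ = cong length (filter-none _ (All.map ≢⇒¬T≡ᵇ x∉))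

count-mono-⊆ : ∀ x → xs ⊆ ys → countᵇ x xs ≤ countᵇ x ys
count-mono-⊆ x xs⊆ys = length-mono-≤ (filter⁺ _ _ (λ { refl h → h }) xs⊆ys)

Nonincreasing : List ℕ → Set
Nonincreasing = AllPairs _≥_

RedOnce : List ℕ → Set
RedOnce l = ∀ x → T (redᵇ x) → countᵇ x l ≤ 1

partᵇ : ℕ → Bool
partᵇ x = (1 ≤ᵇ x) ∧ (blueᵇ x ∨ redᵇ x)

record IsAdmissible (n : ℕ) (l : List ℕ) : Set where
  field
    nonincreasing : Nonincreasing l
    sum≡          : sum l ≡ n
    parts         : All (T ∘ partᵇ) l
    redOnce       : RedOnce l

nonincreasing⁺ : ∀ l → T (nonincreasingᵇ l) → Nonincreasing l
nonincreasing⁺ l h = Linked⇒AllPairs (λ y≤x z≤y → ≤-trans z≤y y≤x) (linked l h)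
  where
  linked : ∀ l → T (nonincreasingᵇ l) → Linked _≥_ l
  linked []          _ = []
  linked (x ∷ [])    _ = [-]
  linked (x ∷ y ∷ l) h = ≤ᵇ⇒≤ y x (proj₁ (T-∧⁻ h)) ∷ linked (y ∷ l) (proj₂ (T-∧⁻ h))

nonincreasing⁻ : ∀ l → Nonincreasing l → T (nonincreasingᵇ l)
nonincreasing⁻ l h = unlinked l (AllPairs⇒Linked h)
  where
  unlinked : ∀ l → Linked _≥_ l → T (nonincreasingᵇ l)
  unlinked []          _           = tt
  unlinked (x ∷ [])    _           = tt
  unlinked (x ∷ y ∷ l) (y≤x ∷ lnk) = T-∧⁺ (≤⇒≤ᵇ y≤x) (unlinked (y ∷ l) lnk)

redOnceᵇ : List ℕ → Bool
redOnceᵇ l = all (λ x → not (redᵇ x) ∨ (countᵇ x l ≤ᵇ 1)) l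

redOnce⁺ : ∀ l → T (redOnceᵇ l) → RedOnce l
redOnce⁺ l h x red with x ∈? l
... | no  x∉l = subst (_≤ 1) (sym (count-absent x (Allₚ.¬Any⇒All¬ l x∉l))) z≤n
... | yes x∈l with Equivalence.to T-∨ (All.lookup (Allₚ.all⁺ _ l h) x∈l)
...   | inj₁ notRed = ⊥-elim (T⇒¬T-not red notRed)
...   | inj₂ once   = ≤ᵇ⇒≤ _ 1 once

redOnce⁻ : ∀ l → RedOnce l → T (redOnceᵇ l)
redOnce⁻ l h = Allₚ.all⁻ _ {xs = l} (All.tabulate λ {x} _ → redOnceAt x)
  where
  redOnceAt : ∀ x → T (not (redᵇ x) ∨ (countᵇ x l ≤ᵇ 1))
  redOnceAt x with redᵇ x in eq
  ... | false = tt
  ... | true  = ≤⇒≤ᵇ (h x (subst T (sym eq) tt))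

isAdmissible⁺ : T (admissibleᵇ n l) → IsAdmissible n l
isAdmissible⁺ {n} {l} h =
  let ni , h₁ = T-∧⁻ {nonincreasingᵇ l} h
      s  , h₂ = T-∧⁻ {sum l ≡ᵇ n} h₁
      ps , ro = T-∧⁻ {all partᵇ l} h₂
  in record { nonincreasing = nonincreasing⁺ l ni ; sum≡ = ≡ᵇ⇒≡ (sum l) n s
            ; parts = Allₚ.all⁺ partᵇ l ps ; redOnce = redOnce⁺ l ro }

isAdmissible⁻ : IsAdmissible n l → T (admissibleᵇ n l)
isAdmissible⁻ {n} {l} a = T-∧⁺ (nonincreasing⁻ l nonincreasing)
  (T-∧⁺ (≡⇒≡ᵇ (sum l) n sum≡) (T-∧⁺ (Allₚ.all⁻ partᵇ parts) (redOnce⁻ l redOnce)))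
  where open IsAdmissible a

AllPairs-resp-⊆ : ∀ {R : ℕ → ℕ → Set} → xs ⊆ ys → AllPairs R ys → AllPairs R xs
AllPairs-resp-⊆ []             []         = []
AllPairs-resp-⊆ (y ∷ʳ xs⊆ys)   (_ ∷ rys)  = AllPairs-resp-⊆ xs⊆ys rys
AllPairs-resp-⊆ (refl ∷ xs⊆ys) (ry ∷ rys) = All-resp-⊆ xs⊆ys ry ∷ AllPairs-resp-⊆ xs⊆ys rys

isAdmissible-⊆ : IsAdmissible n ys → xs ⊆ ys → IsAdmissible (sum xs) xs
isAdmissible-⊆ a xs⊆ys = record
  { nonincreasing = AllPairs-resp-⊆ xs⊆ys nonincreasing
  ; sum≡          = refl
  ; parts         = All-resp-⊆ xs⊆ys parts
  ; redOnce       = λ x red → ≤-trans (count-mono-⊆ x xs⊆ys) (redOnce x red)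
  }
  where open IsAdmissible a

-- Big parts, twos and ones

bigParts : List ℕ → List ℕ
bigParts = filterᵇ (3 ≤ᵇ_)

smallParts : ℕ → ℕ → List ℕ
smallParts t m = replicate t 2 ++ replicate m 1

AllBig : List ℕ → Set
AllBig = All (3 ≤_)

bigᵇ : List ℕ → Bool
bigᵇ P = admissibleᵇ (sum P) P ∧ all (3 ≤ᵇ_) P

isBig⁺ : ∀ {P} → T (bigᵇ P) → IsAdmissible (sum P) P × AllBig P
isBig⁺ {P} h = let a , b = T-∧⁻ {admissibleᵇ (sum P) P} h
               in isAdmissible⁺ a , All.map (≤ᵇ⇒≤ 3 _) (Allₚ.all⁺ _ P b)

isBig⁻ : ∀ {P} → IsAdmissible (sum P) P → AllBig P → T (bigᵇ P)
isBig⁻ a big = T-∧⁺ (isAdmissible⁻ a) (Allₚ.all⁻ _ (All.map ≤⇒≤ᵇ big))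

≤2⇒¬big : ∀ {x} → x ≤ 2 → ¬ T (3 ≤ᵇ x)
≤2⇒¬big x≤2 h = <-irrefl refl (≤-trans (≤ᵇ⇒≤ 3 _ h) x≤2)

bigParts-≤2 : ∀ l → All (_≤ 2) l → bigParts l ≡ []
bigParts-≤2 l ≤2 = filter-none _ (All.map ≤2⇒¬big ≤2)

smallParts-≤2 : ∀ t m → All (_≤ 2) (smallParts t m)
smallParts-≤2 t m = Allₚ.++⁺ (Allₚ.replicate⁺ t ≤-refl) (Allₚ.replicate⁺ m (s≤s z≤n))

bigParts-++-smallParts : ∀ {P} t m → AllBig P → bigParts (P ++ smallParts t m) ≡ P
bigParts-++-smallParts {P} t m big = begin
  bigParts (P ++ smallParts t m)          ≡⟨ filter-++ _ P (smallParts t m) ⟩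
  bigParts P ++ bigParts (smallParts t m) ≡⟨ cong₂ _++_ (filter-all _ (All.map ≤⇒≤ᵇ big))
                                                        (bigParts-≤2 _ (smallParts-≤2 t m)) ⟩
  P ++ []                                 ≡⟨ ++-identityʳ P ⟩
  P                                       ∎
  where open ≡-Reasoning

count-++-smallParts : ∀ {P} x t m → AllBig P → x ≤ 2 →
  countᵇ x (P ++ smallParts t m) ≡ countᵇ x (replicate t 2) + countᵇ x (replicate m 1)
count-++-smallParts {P} x t m big x≤2 = begin
  countᵇ x (P ++ smallParts t m)                      ≡⟨ count-++ x P (smallParts t m) ⟩
  countᵇ x P + countᵇ x (smallParts t m)              ≡⟨ cong₂ _+_ (count-absent x (All.map x≢ big))
                                                                   (count-++ x (replicate t 2) (replicate m 1)) ⟩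
  countᵇ x (replicate t 2) + countᵇ x (replicate m 1) ∎
  where
  open ≡-Reasoning
  x≢ : ∀ {y} → 3 ≤ y → x ≢ y
  x≢ 3≤y refl = <-irrefl refl (≤-<-trans x≤2 3≤y)

twos-++-smallParts : ∀ {P} t m → AllBig P → countᵇ 2 (P ++ smallParts t m) ≡ t
twos-++-smallParts {P} t m big = begin
  countᵇ 2 (P ++ smallParts t m)                      ≡⟨ count-++-smallParts 2 t m big ≤-refl ⟩
  countᵇ 2 (replicate t 2) + countᵇ 2 (replicate m 1) ≡⟨ cong₂ _+_ (count-replicate 2 t)
                                                                   (count-absent 2 (Allₚ.replicate⁺ m λ ())) ⟩
  t + 0                                               ≡⟨ +-identityʳ t ⟩
  t                                                   ∎
  where open ≡-Reasoning

ones-++-smallParts : ∀ {P} t m → AllBig P → countᵇ 1 (P ++ smallParts t m) ≡ m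
ones-++-smallParts t m big = trans (count-++-smallParts 1 t m big (s≤s z≤n))
  (cong₂ _+_ (count-absent 1 (Allₚ.replicate⁺ t λ ())) (count-replicate 1 m))

++-smallParts-injective : ∀ {P P′ t t′ m m′} → AllBig P → AllBig P′ →
  P ++ smallParts t m ≡ P′ ++ smallParts t′ m′ → P ≡ P′ × t ≡ t′ × m ≡ m′
++-smallParts-injective {P} {P′} {t} {t′} {m} {m′} big big′ eq =
  recover bigParts (bigParts-++-smallParts t m big) (bigParts-++-smallParts t′ m′ big′) ,
  recover (countᵇ 2) (twos-++-smallParts t m big) (twos-++-smallParts t′ m′ big′) ,
  recover (countᵇ 1) (ones-++-smallParts t m big) (ones-++-smallParts t′ m′ big′)
  where
  recover : ∀ {X : Set} (f : List ℕ → X) {a b} →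
    f (P ++ smallParts t m) ≡ a → f (P′ ++ smallParts t′ m′) ≡ b → a ≡ b
  recover f e e′ = trans (sym e) (trans (cong f eq) e′)

bigParts++smallParts≡ : ∀ l → Nonincreasing l → All (1 ≤_) l →
  bigParts l ++ smallParts (countᵇ 2 l) (countᵇ 1 l) ≡ l
bigParts++smallParts≡ []      _         _           = refl
bigParts++smallParts≡ (x ∷ l) (x≥ ∷ ni) (1≤x ∷ pos) with bigParts++smallParts≡ l ni pos
bigParts++smallParts≡ (1 ∷ l) (x≥ ∷ ni) (1≤x ∷ pos) | ih = begin
  bigParts l ++ smallParts (countᵇ 2 l) (suc c₁) ≡⟨ cong₂ (λ B t → B ++ smallParts t (suc c₁)) noBig no2 ⟩
  1 ∷ smallParts 0 c₁                             ≡⟨ cong₂ (λ B t → 1 ∷ B ++ smallParts t c₁) noBig no2 ⟨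
  1 ∷ bigParts l ++ smallParts (countᵇ 2 l) c₁    ≡⟨ cong (1 ∷_) ih ⟩
  1 ∷ l                                           ∎
  where
  open ≡-Reasoning
  c₁    = countᵇ 1 l
  noBig = bigParts-≤2 l (All.map m≤n⇒m≤1+n x≥)
  no2   = count-absent {l} 2 (All.map (λ { y≤1 refl → 1+n≰n y≤1 }) x≥)
bigParts++smallParts≡ (2 ∷ l) (x≥ ∷ ni) (1≤x ∷ pos) | ih = begin
  bigParts l ++ 2 ∷ smallParts (countᵇ 2 l) (countᵇ 1 l) ≡⟨ cong (_++ 2 ∷ S) noBig ⟩
  2 ∷ smallParts (countᵇ 2 l) (countᵇ 1 l)               ≡⟨ cong (λ B → 2 ∷ B ++ S) noBig ⟨
  2 ∷ bigParts l ++ smallParts (countᵇ 2 l) (countᵇ 1 l) ≡⟨ cong (2 ∷_) ih ⟩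
  2 ∷ l                                                  ∎
  where
  open ≡-Reasoning
  S     = smallParts (countᵇ 2 l) (countᵇ 1 l)
  noBig = bigParts-≤2 l x≥
bigParts++smallParts≡ (suc (suc (suc y)) ∷ l) _ _ | ih = cong (suc (suc (suc y)) ∷_) ih

sum-replicate : ∀ k x → sum (replicate k x) ≡ k * x
sum-replicate zero    x = refl
sum-replicate (suc k) x = cong (x +_) (sum-replicate k x)

sum-++-smallParts : ∀ P t m → sum (P ++ smallParts t m) ≡ sum P + (t * 2 + m)
sum-++-smallParts P t m = begin
  sum (P ++ smallParts t m)                              ≡⟨ sum-++ P (smallParts t m) ⟩
  sum P + sum (replicate t 2 ++ replicate m 1)           ≡⟨ cong (sum P +_) (sum-++ (replicate t 2) _) ⟩
  sum P + (sum (replicate t 2) + sum (replicate m 1))    ≡⟨ cong (λ s → sum P + (s + _))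
                                                                 (sum-replicate t 2) ⟩
  sum P + (t * 2 + sum (replicate m 1))                  ≡⟨ cong (λ s → sum P + (t * 2 + s))
                                                                 (trans (sum-replicate m 1) (*-identityʳ m)) ⟩
  sum P + (t * 2 + m)                                    ∎
  where open ≡-Reasoning

replicate-nonincreasing : ∀ k x → Nonincreasing (replicate k x)
replicate-nonincreasing zero    x = []
replicate-nonincreasing (suc k) x = Allₚ.replicate⁺ k ≤-refl ∷ replicate-nonincreasing k x

smallParts-nonincreasing : ∀ t m → Nonincreasing (smallParts t m)
smallParts-nonincreasing t m = AllPairsₚ.++⁺ (replicate-nonincreasing t 2) (replicate-nonincreasing m 1)
  (Allₚ.replicate⁺ t (Allₚ.replicate⁺ m (s≤s z≤n)))

redOnce-++-smallParts : ∀ {P} t m → AllBig P → RedOnce P → t ≤ 1 → RedOnce (P ++ smallParts t m)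
redOnce-++-smallParts t m big once t≤1 0 ()
redOnce-++-smallParts t m big once t≤1 1 ()
redOnce-++-smallParts t m big once t≤1 2 _ = ≤-trans (≤-reflexive (twos-++-smallParts t m big)) t≤1
redOnce-++-smallParts {P} t m big once t≤1 x@(suc (suc (suc _))) red = begin
  countᵇ x (P ++ smallParts t m)         ≡⟨ count-++ x P (smallParts t m) ⟩
  countᵇ x P + countᵇ x (smallParts t m) ≡⟨ cong (countᵇ x P +_)
                                                  (count-absent x (All.map x≢ (smallParts-≤2 t m))) ⟩
  countᵇ x P + 0                         ≡⟨ +-identityʳ _ ⟩
  countᵇ x P                             ≤⟨ once x red ⟩
  1                                      ∎
  where
  open ≤-Reasoning
  x≢ : ∀ {y} → y ≤ 2 → x ≢ y
  x≢ (s≤s (s≤s ())) refl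

isAdmissible-++-smallParts : ∀ {P t m} → IsAdmissible (sum P) P → AllBig P → t ≤ 1 →
  sum P + (t * 2 + m) ≡ n → IsAdmissible n (P ++ smallParts t m)
isAdmissible-++-smallParts {P = P} {t} {m} a big t≤1 s = record
  { nonincreasing = AllPairsₚ.++⁺ nonincreasing (smallParts-nonincreasing t m) (All.map big≥small big)
  ; sum≡          = trans (sum-++-smallParts P t m) s
  ; parts         = Allₚ.++⁺ parts (Allₚ.++⁺ (Allₚ.replicate⁺ t tt) (Allₚ.replicate⁺ m tt))
  ; redOnce       = redOnce-++-smallParts t m big redOnce t≤1
  }
  where
  open IsAdmissible a
  big≥small : ∀ {p} → 3 ≤ p → All (_≤ p) (smallParts t m)
  big≥small 3≤p = All.map (λ s≤2 → ≤-trans s≤2 (≤-trans (n≤1+n 2) 3≤p)) (smallParts-≤2 t m)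

admissible-++-smallParts : ∀ {P t m} → T (bigᵇ P) → t ≤ 1 → sum P + (t * 2 + m) ≡ n →
  T (admissibleᵇ n (P ++ smallParts t m))
admissible-++-smallParts {P = P} {t} {m} big t≤1 s =
  let a , ≥3 = isBig⁺ big in isAdmissible⁻ (isAdmissible-++-smallParts {P = P} {t} {m} a ≥3 t≤1 s)

record Decomposition (n : ℕ) (l : List ℕ) : Set where
  constructor decomposition
  field
    big       : List ℕ
    twos ones : ℕ
    shape     : l ≡ big ++ smallParts twos ones
    isBig     : T (bigᵇ big)
    twos≤1    : twos ≤ 1
    sum≡      : sum big + (twos * 2 + ones) ≡ n

decompose : T (admissibleᵇ n l) → Decomposition n l
decompose {n} {l} h = decomposition (bigParts l) (countᵇ 2 l) (countᵇ 1 l) (sym shape)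
  (isBig⁻ (isAdmissible-⊆ a (filter-⊆ _ l)) (All.map (≤ᵇ⇒≤ 3 _) (Allₚ.all-filter _ l)))
  (redOnce 2 tt)
  (begin
    sum (bigParts l) + (countᵇ 2 l * 2 + countᵇ 1 l)         ≡⟨ sum-++-smallParts (bigParts l) _ (countᵇ 1 l) ⟨
    sum (bigParts l ++ smallParts (countᵇ 2 l) (countᵇ 1 l)) ≡⟨ cong sum shape ⟩
    sum l                                                    ≡⟨ sum≡ ⟩
    n                                                        ∎)
  where
  open ≡-Reasoning
  a = isAdmissible⁺ h
  open IsAdmissible a
  shape = bigParts++smallParts≡ l nonincreasing (All.map (λ p → ≤ᵇ⇒≤ 1 _ (proj₁ (T-∧⁻ p))) parts)

redParts-++-smallParts : ∀ P t m → redParts (P ++ smallParts t m) ≡ t + redParts P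
redParts-++-smallParts P t m = begin
  length (filterᵇ redᵇ (P ++ smallParts t m))              ≡⟨ cong length (filter-++ _ P (smallParts t m)) ⟩
  length (filterᵇ redᵇ P ++ filterᵇ redᵇ (smallParts t m)) ≡⟨ length-++ (filterᵇ redᵇ P) ⟩
  redParts P + length (filterᵇ redᵇ (smallParts t m))      ≡⟨ cong (λ xs → redParts P + length xs) redSmall ⟩
  redParts P + length (replicate t 2)                      ≡⟨ cong (redParts P +_) (length-replicate t) ⟩
  redParts P + t                                           ≡⟨ +-comm (redParts P) t ⟩
  t + redParts P                                           ∎
  where
  open ≡-Reasoning
  redSmall : filterᵇ redᵇ (smallParts t m) ≡ replicate t 2
  redSmall = trans (filter-++ _ (replicate t 2) (replicate m 1))
    (trans (cong₂ _++_ (filter-all _ (Allₚ.replicate⁺ t tt)) (filter-none _ (Allₚ.replicate⁺ m λ ())))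
           (++-identityʳ (replicate t 2)))

-- Exchanging a part 2 with two parts 1

-- Chosen so that AdmissibleOfParity true and false are definitionally EvenAdmissible and OddAdmissible.
parityᵇ : Bool → ℕ → Bool
parityᵇ true  r = evenᵇ r
parityᵇ false r = not (evenᵇ r)

parityᵇ-suc : ∀ b r → parityᵇ b (suc r) ≡ parityᵇ (not b) r
parityᵇ-suc true  r = refl
parityᵇ-suc false r = not-involutive (evenᵇ r)

parityᵇ-not-suc : ∀ b r → parityᵇ (not b) (suc r) ≡ parityᵇ b r
parityᵇ-not-suc b r = trans (parityᵇ-suc (not b) r) (cong (λ c → parityᵇ c r) (not-involutive b))

Admissible : ℕ → Set
Admissible n = Σ (List ℕ) (T ∘ admissibleᵇ n)

AdmissibleOfParity : Bool → ℕ → Set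
AdmissibleOfParity b n = Σ (List ℕ) λ l → T (admissibleᵇ n l ∧ parityᵇ b (redParts l))

-- The unpaired partition P ++ smallParts 0 e, all parts of P at least 3, is stored as (P , e).
unpairedᵇ : ℕ → List ℕ × ℕ → Bool
unpairedᵇ n (P , e) = bigᵇ P ∧ (e ≤ᵇ 1) ∧ (sum P + e ≡ᵇ n)

Unpaired : ℕ → Set
Unpaired n = Σ (List ℕ × ℕ) (T ∘ unpairedᵇ n)

unpaired⁻ : ∀ {P e} → T (bigᵇ P) → e ≤ 1 → sum P + e ≡ n → T (unpairedᵇ n (P , e))
unpaired⁻ {n} {P} {e} big e≤1 s = T-∧⁺ big (T-∧⁺ (≤⇒≤ᵇ e≤1) (≡⇒≡ᵇ (sum P + e) n s))

record IsUnpaired (n : ℕ) (P : List ℕ) (e : ℕ) : Set where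
  field
    admissible : IsAdmissible (sum P) P
    big        : AllBig P
    e≤1        : e ≤ 1
    sum≡       : sum P + e ≡ n

  sum≤ : sum P ≤ n
  sum≤ = m+n≤o⇒m≤o (sum P) (≤-reflexive sum≡)

  e≤part : ∀ {v} → v ∈ P → e ≤ v
  e≤part v∈P = ≤-trans e≤1 (≤-trans (s≤s z≤n) (All.lookup big v∈P))

isUnpaired⁺ : ∀ {P e b} → T (unpairedᵇ n (P , e) ∧ b) → IsUnpaired n P e
isUnpaired⁺ {n} {P} {e} h =
  let u , _     = T-∧⁻ {unpairedᵇ n (P , e)} h
      isBig , h′ = T-∧⁻ {bigᵇ P} u
      e≤1 , s   = T-∧⁻ {e ≤ᵇ 1} h′
      a , big   = isBig⁺ {P} isBig
  in record { admissible = a ; big = big ; e≤1 = ≤ᵇ⇒≤ e 1 e≤1 ; sum≡ = ≡ᵇ⇒≡ _ n s }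

swapParity : ∀ b P {t m t′ m′} → parityᵇ b (t + redParts P) ≡ parityᵇ (not b) (t′ + redParts P) →
  T (parityᵇ b (redParts (P ++ smallParts t m))) → T (parityᵇ (not b) (redParts (P ++ smallParts t′ m′)))
swapParity b P {t} {m} {t′} {m′} e = subst T (begin
  parityᵇ b (redParts (P ++ smallParts t m))         ≡⟨ cong (parityᵇ b) (redParts-++-smallParts P t m) ⟩
  parityᵇ b (t + redParts P)                         ≡⟨ e ⟩
  parityᵇ (not b) (t′ + redParts P)                  ≡⟨ cong (parityᵇ (not b))
                                                             (redParts-++-smallParts P t′ m′) ⟨
  parityᵇ (not b) (redParts (P ++ smallParts t′ m′)) ∎)
  where open ≡-Reasoning

swapOf : ∀ b → Decomposition n l → T (parityᵇ b (redParts l)) → AdmissibleOfParity (not b) n ⊎ Unpaired n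
swapOf b (decomposition P 0 0 refl big _ s) _ = inj₂ ((P , 0) , unpaired⁻ {P = P} big z≤n s)
swapOf b (decomposition P 0 1 refl big _ s) _ = inj₂ ((P , 1) , unpaired⁻ {P = P} big ≤-refl s)
swapOf b (decomposition P 0 (suc (suc m)) refl big _ s) par =
  inj₁ (P ++ smallParts 1 m , T-∧⁺ (admissible-++-smallParts {P = P} big ≤-refl s)
                                   (swapParity b P (sym (parityᵇ-not-suc b (redParts P))) par))
swapOf b (decomposition P 1 m refl big _ s) par =
  inj₁ (P ++ smallParts 0 (2 + m) , T-∧⁺ (admissible-++-smallParts {P = P} big z≤n s)
                                         (swapParity b P (parityᵇ-suc b (redParts P)) par))
swapOf b (decomposition P (suc (suc _)) _ _ _ (s≤s ()) _) _

swap : ∀ b n → AdmissibleOfParity b n → AdmissibleOfParity (not b) n ⊎ Unpaired n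
swap b n (l , h) = let a , par = T-∧⁻ {admissibleᵇ n l} h in swapOf b (decompose {n} {l} a) par

swapSmall : List ℕ → ℕ → ℕ → List ℕ
swapSmall P 1 m = P ++ smallParts 0 (2 + m)
swapSmall P _ m = P ++ smallParts 1 (m ∸ 2)

unswap : ∀ b n → AdmissibleOfParity b n ⊎ Unpaired n → List ℕ
unswap b n (inj₁ (l , _))       = swapSmall (bigParts l) (countᵇ 2 l) (countᵇ 1 l)
unswap b n (inj₂ ((P , e) , _)) = P ++ smallParts 0 e

swapSmall-++-smallParts : ∀ {P} t m → AllBig P →
  let l = P ++ smallParts t m in swapSmall (bigParts l) (countᵇ 2 l) (countᵇ 1 l) ≡ swapSmall P t m
swapSmall-++-smallParts t m big
  rewrite bigParts-++-smallParts t m big | twos-++-smallParts t m big | ones-++-smallParts t m big = refl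

unswap-swapOf : ∀ b (d : Decomposition n l) par → unswap (not b) n (swapOf b d par) ≡ l
unswap-swapOf b (decomposition P 0 0 refl big _ s) _ = refl
unswap-swapOf b (decomposition P 0 1 refl big _ s) _ = refl
unswap-swapOf b (decomposition P 0 (suc (suc m)) refl big _ s) _ =
  swapSmall-++-smallParts 1 m (proj₂ (isBig⁺ big))
unswap-swapOf b (decomposition P 1 m refl big _ s) _ =
  swapSmall-++-smallParts 0 (2 + m) (proj₂ (isBig⁺ big))
unswap-swapOf b (decomposition P (suc (suc _)) _ _ _ (s≤s ()) _) _

swap-↣ : ∀ b n → AdmissibleOfParity b n ↣ (AdmissibleOfParity (not b) n ⊎ Unpaired n)
swap-↣ b n = mk↣-via (swap b n) (unswap (not b) n) proj₁-injective λ (l , h) →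
  let a , par = T-∧⁻ {admissibleᵇ n l} h in unswap-swapOf b (decompose {n} {l} a) par

-- Unpaired partitions are rare

push : ℕ → List (ℕ × ℕ) → List (ℕ × ℕ)
push x []            = (x , 1) ∷ []
push x ((y , c) ∷ r) with x ≟ y
... | yes _ = (y , suc c) ∷ r
... | no  _ = (x , 1) ∷ (y , c) ∷ r

runs : List ℕ → List (ℕ × ℕ)
runs []      = []
runs (x ∷ l) = push x (runs l)

unruns : List (ℕ × ℕ) → List ℕ
unruns []            = []
unruns ((v , c) ∷ r) = replicate c v ++ unruns r

unruns-push : ∀ x r → unruns (push x r) ≡ x ∷ unruns r
unruns-push x []            = refl
unruns-push x ((y , c) ∷ r) with x ≟ y
... | yes refl = refl
... | no  _    = refl

unruns-runs : ∀ l → unruns (runs l) ≡ l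
unruns-runs []      = refl
unruns-runs (x ∷ l) = trans (unruns-push x (runs l)) (cong (x ∷_) (unruns-runs l))

runs-injective : Injective _≡_ _≡_ runs
runs-injective {l} {l′} eq = trans (sym (unruns-runs l)) (trans (cong unruns eq) (unruns-runs l′))

IsRunOf : List ℕ → ℕ × ℕ → Set
IsRunOf l (v , c) = v ∈ l × 1 ≤ c

push-runOf : ∀ x {l} r → All (IsRunOf l) r → All (IsRunOf (x ∷ l)) (push x r)
push-runOf x []            _                 = (here refl , ≤-refl) ∷ []
push-runOf x ((y , c) ∷ r) ((y∈ , 1≤c) ∷ rs) with x ≟ y
... | yes _ = (there y∈ , s≤s z≤n) ∷ All.map (λ (v∈ , 1≤d) → there v∈ , 1≤d) rs
... | no  _ = (here refl , ≤-refl) ∷ (there y∈ , 1≤c) ∷ All.map (λ (v∈ , 1≤d) → there v∈ , 1≤d) rs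

runs-runOf : ∀ l → All (IsRunOf l) (runs l)
runs-runOf []      = []
runs-runOf (x ∷ l) = push-runOf x (runs l) (runs-runOf l)

Decreasing : List (ℕ × ℕ) → Set
Decreasing = AllPairs (λ a b → proj₁ b < proj₁ a)

push-decreasing : ∀ x r → All (λ (v , _) → v ≤ x) r → Decreasing r → Decreasing (push x r)
push-decreasing x []            _           _          = [] ∷ []
push-decreasing x ((y , c) ∷ r) (y≤x ∷ _) (y> ∷ dec) with x ≟ y
... | yes _   = y> ∷ dec
... | no  x≢y = (y<x ∷ All.map (λ v<y → <-trans v<y y<x) y>) ∷ y> ∷ dec
  where y<x = ≤∧≢⇒< y≤x (x≢y ∘ sym)

runs-decreasing : ∀ l → Nonincreasing l → Decreasing (runs l)
runs-decreasing []      _         = []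
runs-decreasing (x ∷ l) (x≥ ∷ ni) =
  push-decreasing x (runs l) (All.map (λ (v∈ , _) → All.lookup x≥ v∈) (runs-runOf l)) (runs-decreasing l ni)

unruns-term≤ : ∀ (r : List (ℕ × ℕ)) → All (λ (v , c) → c * v ≤ sum (unruns r)) r
unruns-term≤ []            = []
unruns-term≤ ((v , c) ∷ r) =
  subst (c * v ≤_) (sym total) (m≤m+n (c * v) _) ∷
  All.map (λ le → ≤-trans le (subst (sum (unruns r) ≤_) (sym total) (m≤n+m _ (c * v)))) (unruns-term≤ r)
  where
  total : sum (replicate c v ++ unruns r) ≡ c * v + sum (unruns r)
  total = trans (sum-++ (replicate c v) (unruns r)) (cong (_+ sum (unruns r)) (sum-replicate c v))

runs-term≤sum : ∀ l → All (λ (v , c) → c * v ≤ sum l) (runs l)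
runs-term≤sum l =
  subst (λ l′ → All (λ (v , c) → c * v ≤ sum l′) (runs l)) (unruns-runs l) (unruns-term≤ (runs l))

values : List ℕ → List ℕ
values l = map proj₁ (runs l)

values-∈ : ∀ l → All (_∈ l) (values l)
values-∈ l = Allₚ.map⁺ (All.map proj₁ (runs-runOf l))

values-unique : ∀ l → Nonincreasing l → AllPairs _≢_ (values l)
values-unique l ni = AllPairsₚ.map⁺ (AllPairs.map >⇒≢ (runs-decreasing l ni))

lookup-injective : ∀ {xs : List A} → AllPairs _≢_ xs → ∀ {i j} → lookup xs i ≡ lookup xs j → i ≡ j
lookup-injective (x≢ ∷ u) {Fin.zero}  {Fin.zero}  _  = refl
lookup-injective (x≢ ∷ u) {Fin.zero}  {Fin.suc j} eq = ⊥-elim (All.lookup x≢ (∈-lookup j) eq)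
lookup-injective (x≢ ∷ u) {Fin.suc i} {Fin.zero}  eq = ⊥-elim (All.lookup x≢ (∈-lookup i) (sym eq))
lookup-injective (x≢ ∷ u) {Fin.suc i} {Fin.suc j} eq = cong Fin.suc (lookup-injective u eq)

lookup-inject≤-injective : ∀ {k} {xs ys : List A} → xs ≡ ys → AllPairs _≢_ xs →
  ∀ {i j : Fin k} le le′ → lookup xs (inject≤ i le) ≡ lookup ys (inject≤ j le′) → i ≡ j
lookup-inject≤-injective refl unique {i} {j} le le′ eq =
  inject≤-injective le le′ i j (lookup-injective unique eq)

removeOne : ℕ → List ℕ → List ℕ
removeOne v []       = []
removeOne v (x ∷ xs) with x ≟ v
... | yes _ = xs
... | no  _ = x ∷ removeOne v xs

insert : ℕ → List ℕ → List ℕ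
insert v []       = v ∷ []
insert v (x ∷ xs) with x ≤? v
... | yes _ = v ∷ x ∷ xs
... | no  _ = x ∷ insert v xs

removeOne-⊆ : ∀ v xs → removeOne v xs ⊆ xs
removeOne-⊆ v []       = []
removeOne-⊆ v (x ∷ xs) with x ≟ v
... | yes _ = x ∷ʳ ⊆-refl
... | no  _ = refl ∷ removeOne-⊆ v xs

sum-removeOne : ∀ {v xs} → v ∈ xs → sum (removeOne v xs) + v ≡ sum xs
sum-removeOne {v} {x ∷ xs} v∈ with x ≟ v | v∈
... | yes refl | _          = +-comm (sum xs) x
... | no  x≢v  | here v≡x   = ⊥-elim (x≢v (sym v≡x))
... | no  _    | there v∈xs = trans (+-assoc x _ v) (cong (x +_) (sum-removeOne v∈xs))

insert-removeOne : ∀ {v xs} → Nonincreasing xs → v ∈ xs → insert v (removeOne v xs) ≡ xs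
insert-removeOne {v} {x ∷ xs} (x≥ ∷ ni) v∈ with x ≟ v | v∈
... | yes refl | _          = insert-≥ xs x≥
  where
  insert-≥ : ∀ ys → All (_≤ x) ys → insert x ys ≡ x ∷ ys
  insert-≥ []       _         = refl
  insert-≥ (y ∷ ys) (y≤x ∷ _) with y ≤? x
  ... | yes _   = refl
  ... | no  y≰x = ⊥-elim (y≰x y≤x)
... | no  x≢v  | here v≡x   = ⊥-elim (x≢v (sym v≡x))
... | no  x≢v  | there v∈xs with x ≤? v
...   | yes x≤v = ⊥-elim (x≢v (≤-antisym x≤v (All.lookup x≥ v∈xs)))
...   | no  _   = cong (x ∷_) (insert-removeOne ni v∈xs)

fromDigits : ℕ → List ℕ → ℕ
fromDigits B []       = 0
fromDigits B (d ∷ ds) = d + fromDigits B ds * B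

fromDigits-< : ∀ B ds → All (_< B) ds → fromDigits B ds < B ^ length ds
fromDigits-< B []       []          = s≤s z≤n
fromDigits-< B (d ∷ ds) (d<B ∷ ds<) = begin-strict
  d + fromDigits B ds * B   <⟨ +-monoˡ-< (fromDigits B ds * B) d<B ⟩
  suc (fromDigits B ds) * B ≤⟨ *-monoˡ-≤ B (fromDigits-< B ds ds<) ⟩
  B ^ length ds * B         ≡⟨ *-comm (B ^ length ds) B ⟩
  B ^ length (d ∷ ds)       ∎
  where open ≤-Reasoning

-- Digits are positive so that digit lists of different lengths have different values.
IsDigit : ℕ → ℕ → Set
IsDigit B d = 0 < d × d < B

fromDigits-injective : ∀ B .{{_ : NonZero B}} {ds ds′} → All (IsDigit B) ds → All (IsDigit B) ds′ →
  fromDigits B ds ≡ fromDigits B ds′ → ds ≡ ds′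
fromDigits-injective B []              []              _  = refl
fromDigits-injective B []              ((0<d , _) ∷ _) eq = ⊥-elim (<⇒≢ 0<d (sym (m+n≡0⇒m≡0 _ (sym eq))))
fromDigits-injective B ((0<d , _) ∷ _) []              eq = ⊥-elim (<⇒≢ 0<d (sym (m+n≡0⇒m≡0 _ eq)))
fromDigits-injective B {d ∷ ds} {d′ ∷ ds′} ((_ , d<B) ∷ digits) ((_ , d′<B) ∷ digits′) eq =
  cong₂ _∷_ d≡d′ (fromDigits-injective B digits digits′
    (*-cancelʳ-≡ _ _ B (+-cancelˡ-≡ d _ _ (trans eq (cong (_+ _) (sym d≡d′))))))
  where
  open ≡-Reasoning
  d≡d′ : d ≡ d′
  d≡d′ = begin
    d                               ≡⟨ m<n⇒m%n≡m d<B ⟨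
    d % B                           ≡⟨ [m+kn]%n≡m%n d (fromDigits B ds) B ⟨
    (d + fromDigits B ds * B) % B   ≡⟨ cong (_% B) eq ⟩
    (d′ + fromDigits B ds′ * B) % B ≡⟨ [m+kn]%n≡m%n d′ (fromDigits B ds′) B ⟩
    d′ % B                          ≡⟨ m<n⇒m%n≡m d′<B ⟩
    d′                              ∎

flatten : List (ℕ × ℕ) → List ℕ
flatten []            = []
flatten ((v , c) ∷ r) = v ∷ c ∷ flatten r

flatten-injective : Injective _≡_ _≡_ flatten
flatten-injective {[]}          {[]}             _  = refl
flatten-injective {(v , c) ∷ r} {(v′ , c′) ∷ r′} eq
  with refl , eq₁ ← ∷-injective eq
  with refl , eq₂ ← ∷-injective eq₁ = cong ((v , c) ∷_) (flatten-injective eq₂)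

length-flatten : ∀ r → length (flatten r) ≡ 2 * length r
length-flatten []            = refl
length-flatten ((v , c) ∷ r) = trans (cong (2 +_) (length-flatten r)) (sym (*-suc 2 (length r)))

flatten⁺ : ∀ {Q : ℕ → Set} {r} → All (λ (v , c) → Q v × Q c) r → All Q (flatten r)
flatten⁺ []               = []
flatten⁺ ((qv , qc) ∷ qs) = qv ∷ qc ∷ flatten⁺ qs

runs-digits : ∀ {P} → AllBig P → sum P ≤ n → All (IsDigit (suc n)) (flatten (runs P))
runs-digits {n} {P} big sum≤n = flatten⁺ (All.map digits (All.zip (runs-runOf P , runs-term≤sum P)))
  where
  digits : ∀ {(v , c) : ℕ × ℕ} → IsRunOf P (v , c) × c * v ≤ sum P →
    IsDigit (suc n) v × IsDigit (suc n) c
  digits {v , c} ((v∈ , 1≤c) , cv≤) =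
    let 1≤v  = ≤-trans (s≤s z≤n) (All.lookup big v∈)
        cv≤n = ≤-trans cv≤ sum≤n
    in (1≤v , s≤s (≤-trans (m≤n*m v c {{>-nonZero 1≤c}}) cv≤n)) ,
       (1≤c , s≤s (≤-trans (m≤m*n c v {{>-nonZero 1≤v}}) cv≤n))

breakUp : ℕ → List ℕ → ℕ → List ℕ
breakUp v P e = removeOne v P ++ smallParts e (v ∸ e)

e*2+[v∸e]≡v+e : ∀ {e v} → e ≤ v → e * 2 + (v ∸ e) ≡ v + e
e*2+[v∸e]≡v+e {e} {v} e≤v = begin
  e * 2 + (v ∸ e)   ≡⟨ cong (_+ (v ∸ e)) (trans (*-comm e 2) (cong (e +_) (+-identityʳ e))) ⟩
  e + e + (v ∸ e)   ≡⟨ +-assoc e e (v ∸ e) ⟩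
  e + (e + (v ∸ e)) ≡⟨ cong (e +_) (m+[n∸m]≡n e≤v) ⟩
  e + v             ≡⟨ +-comm e v ⟩
  v + e             ∎
  where open ≡-Reasoning

breakUp-admissible : ∀ {P e v} → IsUnpaired n P e → v ∈ P → T (admissibleᵇ n (breakUp v P e))
breakUp-admissible {n} {P} {e} {v} u v∈P = admissible-++-smallParts {P = rest}
  (isBig⁻ (isAdmissible-⊆ admissible rest⊆P) (All-resp-⊆ rest⊆P big)) e≤1 (begin
    sum rest + (e * 2 + (v ∸ e)) ≡⟨ cong (sum rest +_) (e*2+[v∸e]≡v+e (e≤part v∈P)) ⟩
    sum rest + (v + e)           ≡⟨ +-assoc (sum rest) v e ⟨
    sum rest + v + e             ≡⟨ cong (_+ e) (sum-removeOne v∈P) ⟩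
    sum P + e                    ≡⟨ sum≡ ⟩
    n                            ∎)
  where
  open ≡-Reasoning
  open IsUnpaired u
  rest = removeOne v P
  rest⊆P = removeOne-⊆ v P

breakUp-injective : ∀ {P P′ e e′ v v′} → IsUnpaired n P e → IsUnpaired n P′ e′ →
  v ∈ P → v′ ∈ P′ → breakUp v P e ≡ breakUp v′ P′ e′ → v ≡ v′ × P ≡ P′ × e ≡ e′
breakUp-injective {P = P} {P′} {e} {e′} {v} {v′} u u′ v∈P v′∈P′ eq
  with rest≡ , refl , diff≡ ← ++-smallParts-injective {t = e} {e′} {v ∸ e} {v′ ∸ e′}
         (All-resp-⊆ (removeOne-⊆ v P) (IsUnpaired.big u))
         (All-resp-⊆ (removeOne-⊆ v′ P′) (IsUnpaired.big u′)) eq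
  = v≡v′ , P≡P′ , refl
  where
  nonincreasing : ∀ {Q f} → IsUnpaired n Q f → Nonincreasing Q
  nonincreasing = IsAdmissible.nonincreasing ∘ IsUnpaired.admissible
  v≡v′ : v ≡ v′
  v≡v′ = begin
    v           ≡⟨ m∸n+n≡m (IsUnpaired.e≤part u v∈P) ⟨
    v ∸ e + e   ≡⟨ cong (_+ e) diff≡ ⟩
    v′ ∸ e + e  ≡⟨ m∸n+n≡m (IsUnpaired.e≤part u′ v′∈P′) ⟩
    v′          ∎
    where open ≡-Reasoning
  P≡P′ : P ≡ P′
  P≡P′ = begin
    P                           ≡⟨ insert-removeOne (nonincreasing u) v∈P ⟨
    insert v (removeOne v P)    ≡⟨ cong₂ insert v≡v′ rest≡ ⟩
    insert v′ (removeOne v′ P′) ≡⟨ insert-removeOne (nonincreasing u′) v′∈P′ ⟩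
    P′                          ∎
    where open ≡-Reasoning

manyValuesᵇ : ℕ → List ℕ × ℕ → Bool
manyValuesᵇ M (P , _) = M ≤ᵇ length (values P)

ManyValued FewValued : ℕ → ℕ → Set
ManyValued M n = P∧Q  (unpairedᵇ n) (manyValuesᵇ M)
FewValued  M n = P∧¬Q (unpairedᵇ n) (manyValuesᵇ M)

module _ (M n : ℕ) where

  private
    enoughValues : ∀ {P e} → T (unpairedᵇ n (P , e) ∧ manyValuesᵇ M (P , e)) → M ≤ length (values P)
    enoughValues {P} {e} h = ≤ᵇ⇒≤ M (length (values P)) (proj₂ (T-∧⁻ {unpairedᵇ n (P , e)} h))

    chosenValue : Fin M × ManyValued M n → ℕ
    chosenValue (j , (P , _) , h) = lookup (values P) (inject≤ j (enoughValues {P} h))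

    chosenValue-∈ : ∀ x → chosenValue x ∈ proj₁ (proj₁ (proj₂ x))
    chosenValue-∈ (j , (P , _) , h) = All.lookup (values-∈ P) (∈-lookup _)

    breakUpValue : Fin M × ManyValued M n → Admissible n
    breakUpValue x@(j , (P , e) , h) =
      breakUp (chosenValue x) P e , breakUp-admissible (isUnpaired⁺ {P = P} h) (chosenValue-∈ x)

    breakUpValue-injective : Injective _≡_ _≡_ breakUpValue
    breakUpValue-injective {x@(j , (P , e) , h)} {x′@(j′ , (P′ , e′) , h′)} eq =
      let u = isUnpaired⁺ {P = P} h
          v≡v′ , P≡P′ , e≡e′ = breakUp-injective u (isUnpaired⁺ {P = P′} h′)
                                 (chosenValue-∈ x) (chosenValue-∈ x′) (cong proj₁ eq)
          unique = values-unique P (IsAdmissible.nonincreasing (IsUnpaired.admissible u))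
      in cong₂ _,_
           (lookup-inject≤-injective (cong values P≡P′) unique (enoughValues {P} h) (enoughValues {P′} h′) v≡v′)
           (proj₁-injective (cong₂ _,_ P≡P′ e≡e′))

  manyValued-↣ : (Fin M × ManyValued M n) ↣ Admissible n
  manyValued-↣ = mk↣ breakUpValue-injective

  private
    fewValues : ∀ {P e} → T (unpairedᵇ n (P , e) ∧ not (manyValuesᵇ M (P , e))) → length (runs P) < M
    fewValues {P} {e} h = subst (_< M) (length-map proj₁ (runs P))
      (≰⇒> λ M≤ → T⇒¬T-not (≤⇒≤ᵇ M≤) (proj₂ (T-∧⁻ {unpairedᵇ n (P , e)} h)))

    code : FewValued M n → ℕ
    code ((P , _) , _) = fromDigits (suc n) (flatten (runs P))

    code-< : ∀ u → code u < suc n ^ (2 * M)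
    code-< ((P , e) , h) = begin-strict
      fromDigits (suc n) (flatten (runs P)) <⟨ fromDigits-< (suc n) _ (All.map proj₂ (runs-digits big sum≤)) ⟩
      suc n ^ length (flatten (runs P))     ≡⟨ cong (suc n ^_) (length-flatten (runs P)) ⟩
      suc n ^ (2 * length (runs P))         ≤⟨ ^-monoʳ-≤ (suc n) (*-monoʳ-≤ 2 (<⇒≤ (fewValues {P} h))) ⟩
      suc n ^ (2 * M)                       ∎
      where
      open ≤-Reasoning
      open IsUnpaired (isUnpaired⁺ {P = P} h)

    code-injective : Injective _≡_ _≡_ code
    code-injective {(P , e) , h} {(P′ , e′) , h′} eq =
      let u  = isUnpaired⁺ {P = P} h
          u′ = isUnpaired⁺ {P = P′} h′
          P≡P′ = runs-injective (flatten-injective (fromDigits-injective (suc n)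
                   (runs-digits (IsUnpaired.big u) (IsUnpaired.sum≤ u))
                   (runs-digits (IsUnpaired.big u′) (IsUnpaired.sum≤ u′)) eq))
          e≡e′ = +-cancelˡ-≡ (sum P) e e′ (trans (IsUnpaired.sum≡ u)
                   (trans (sym (IsUnpaired.sum≡ u′)) (cong (λ Q → sum Q + e′) (sym P≡P′))))
      in proj₁-injective (cong₂ _,_ P≡P′ e≡e′)

  fewValued-↣ : FewValued M n ↣ Fin (suc n ^ (2 * M))
  fewValued-↣ = mk↣-via (λ u → fromℕ< (code-< u)) toℕ code-injective (λ u → toℕ-fromℕ< (code-< u))

  unpaired-↣ : ∀ {a} → Admissible n ↣ Fin a → (Fin M × Unpaired n) ↣ Fin (a + M * suc n ^ (2 * M))
  unpaired-↣ {a} adm = begin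
    (Fin M × Unpaired n)                                 ∼⟨ ↣-id _ ×-↣ split-↣ _ _ ⟩
    (Fin M × (ManyValued M n ⊎ FewValued M n))           ↔⟨ ×-distribˡ-⊎ _ _ _ _ ⟩
    ((Fin M × ManyValued M n) ⊎ (Fin M × FewValued M n)) ∼⟨ manyValued-↣ ⊎-↣ (↣-id _ ×-↣ fewValued-↣) ⟩
    (Admissible n ⊎ (Fin M × Fin (suc n ^ (2 * M))))     ∼⟨ adm ⊎-↣ ↔⇒↣ (↔-sym *↔×) ⟩
    (Fin a ⊎ Fin (M * suc n ^ (2 * M)))                  ↔⟨ +↔⊎ ⟨
    Fin (a + M * suc n ^ (2 * M))                        ∎
    where open EquationalReasoning {k = injection}

admissible-↣ : ∀ {n a b} → Fin a ↔ EvenAdmissible n → Fin b ↔ OddAdmissible n →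
  Admissible n ↣ Fin (a + b)
admissible-↣ {n} {a} {b} even odd = begin
  Admissible n                         ∼⟨ split-↣ (admissibleᵇ n) (evenᵇ ∘ redParts) ⟩
  (EvenAdmissible n ⊎ OddAdmissible n) ↔⟨ even ⊎-↔ odd ⟨
  (Fin a ⊎ Fin b)                      ↔⟨ +↔⊎ ⟨
  Fin (a + b)                          ∎
  where open EquationalReasoning {k = injection}

parity-bound : ∀ b n M {c c′ a} → Fin c ↔ AdmissibleOfParity b n →
  AdmissibleOfParity (not b) n ↣ Fin c′ → Admissible n ↣ Fin a → M * c ≤ M * c′ + (a + M * suc n ^ (2 * M))
parity-bound b n M {c} {c′} {a} iso other adm = ↣⇒≤ (begin
  Fin (M * c)                                                     ↔⟨ *↔× ⟩
  (Fin M × Fin c)                                                 ↔⟨ ↔-id _ ×-↔ iso ⟩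
  (Fin M × AdmissibleOfParity b n)                                ∼⟨ ↣-id _ ×-↣ swap-↣ b n ⟩
  (Fin M × (AdmissibleOfParity (not b) n ⊎ Unpaired n))           ↔⟨ ×-distribˡ-⊎ _ _ _ _ ⟩
  ((Fin M × AdmissibleOfParity (not b) n) ⊎ (Fin M × Unpaired n)) ∼⟨ (↣-id _ ×-↣ other) ⊎-↣ unpaired-↣ _ _ adm ⟩
  ((Fin M × Fin c′) ⊎ Fin (a + M * suc n ^ (2 * M)))              ↔⟨ *↔× ⊎-↔ ↔-id _ ⟨
  (Fin (M * c′) ⊎ Fin (a + M * suc n ^ (2 * M)))                  ↔⟨ +↔⊎ ⟨
  Fin (M * c′ + (a + M * suc n ^ (2 * M)))                        ∎)
  where open EquationalReasoning {k = injection}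

∣-∣≤ : ∀ {a b c} → a ≤ b + c → b ≤ a + c → ∣ a - b ∣ ≤ c
∣-∣≤ {a} {b} a≤ b≤ with ≤-total a b
... | inj₁ a≤b = subst (_≤ _) (sym (m≤n⇒∣m-n∣≡n∸m a≤b)) (m≤n+o⇒m∸n≤o b a b≤)
... | inj₂ b≤a = subst (_≤ _) (sym (m≤n⇒∣n-m∣≡n∸m b≤a)) (m≤n+o⇒m∸n≤o a b a≤)

M*∣O-E∣≤ : ∀ n M {E O} → Fin E ↔ EvenAdmissible n → Fin O ↔ OddAdmissible n →
  M * ∣ O - E ∣ ≤ E + O + M * suc n ^ (2 * M)
M*∣O-E∣≤ n M {E} {O} even odd = subst (_≤ E + O + M * suc n ^ (2 * M)) (sym (*-distribˡ-∣-∣ M O E))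
  (∣-∣≤ (parity-bound false n M odd (↔⇒↣ (↔-sym even)) adm)
        (parity-bound true  n M even (↔⇒↣ (↔-sym odd))  adm))
  where adm = admissible-↣ even odd

-- Blue numbers and many even admissible partitions

prime⇒2≤ : ∀ {p} → Prime p → 2 ≤ p
prime⇒2≤ {p} pp = nonTrivial⇒n>1 p {{prime⇒nonTrivial pp}}

primeDivisor : ∀ {n} → 2 ≤ n → ∃ λ p → Prime p × p ∣ n
primeDivisor {n} 2≤n with factorise n {{>-nonZero (≤-trans (s≤s z≤n) 2≤n)}}
... | record { factors = [] ; isFactorisation = n≡1 } = ⊥-elim (<-irrefl (sym n≡1) 2≤n)
... | record { factors = p ∷ ps ; isFactorisation = n≡ ; factorsPrime = pp ∷ _ } =
  p , pp , subst (p ∣_) (sym n≡) (m∣m*n (product ps))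

∣n! : ∀ {m n} → 1 ≤ m → m ≤ n → m ∣ n !
∣n! {suc k} _ m≤n = ∣-trans (m∣m*n (k !)) (m≤n⇒m!∣n! m≤n)

-- Opaque, so that type checking never tries to evaluate the factorial below.
opaque
  prime> : ∀ N → ∃ λ p → Prime p × N < p
  prime> N with p , pp , p∣ ← primeDivisor {N ! + 1} (+-monoˡ-≤ 1 (1≤n! N)) with N <? p
  ... | yes N<p = p , pp , N<p
  ... | no  N≮p = ⊥-elim (¬prime[1] (subst Prime (∣1⇒≡1 p∣1) pp))
    where
    p∣1 : p ∣ 1
    p∣1 = ∣m+n∣m⇒∣n p∣ (∣n! (≤-trans (s≤s z≤n) (prime⇒2≤ pp)) (≮⇒≥ N≮p))

prime∣prime⇒≡ : ∀ {p q} → Prime p → Prime q → p ∣ q → p ≡ q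
prime∣prime⇒≡ pp pq p∣q with prime⇒irreducible pq p∣q
... | inj₁ refl = ⊥-elim (¬prime[1] pp)
... | inj₂ p≡q  = p≡q

prime∣p*q : ∀ {r p q} → Prime r → Prime p → Prime q → r ∣ p * q → r ≡ p ⊎ r ≡ q
prime∣p*q pr pp pq r∣pq with euclidsLemma _ _ pr r∣pq
... | inj₁ r∣p = inj₁ (prime∣prime⇒≡ pr pp r∣p)
... | inj₂ r∣q = inj₂ (prime∣prime⇒≡ pr pq r∣q)

squarefree⁺ : ∀ {m} → 1 ≤ m → (∀ d → 2 ≤ d → ¬ d * d ∣ m) → T (squarefreeᵇ m)
squarefree⁺ {m} 1≤m noSquare =
  T-∧⁺ (≤⇒≤ᵇ 1≤m) (Allₚ.all⁻ _ (All.universal noSquareᵇ (upTo (suc m))))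
  where
  noSquareᵇ : ∀ d → T (not ((2 ≤ᵇ d) ∧ does (d * d ∣? m)))
  noSquareᵇ d with 2 ≤ᵇ d in 2≤d | d * d ∣? m
  ... | false | _       = tt
  ... | true  | no  _   = tt
  ... | true  | yes dd∣ = noSquare d (≤ᵇ⇒≤ 2 d (subst T (sym 2≤d) tt)) dd∣

squarefree-p*q : ∀ {p q} → Prime p → Prime q → p ≢ q → T (squarefreeᵇ (p * q))
squarefree-p*q {p} {q} pp pq p≢q = squarefree⁺ (*-mono-≤ (1≤prime pp) (1≤prime pq)) λ d 2≤d dd∣ →
  let r , pr , r∣d = primeDivisor 2≤d in noPrimeSquare pr (∣-trans (*-pres-∣ r∣d r∣d) dd∣)
  where
  1≤prime : ∀ {r} → Prime r → 1 ≤ r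
  1≤prime pr = ≤-trans (s≤s z≤n) (prime⇒2≤ pr)
  noPrimeSquare : ∀ {r} → Prime r → ¬ r * r ∣ p * q
  noPrimeSquare {r} pr rr∣ with prime∣p*q pr pp pq (∣-trans (m∣m*n r) rr∣)
  ... | inj₁ refl = p≢q (prime∣prime⇒≡ pp pq (*-cancelˡ-∣ p {{prime⇒nonZero pp}} rr∣))
  ... | inj₂ refl = p≢q (sym (prime∣prime⇒≡ pq pp
                      (*-cancelˡ-∣ q {{prime⇒nonZero pq}} (subst (q * q ∣_) (*-comm p q) rr∣))))

countUpTo : (ℕ → Bool) → ℕ → ℕ
countUpTo f n = length (filterᵇ f (upTo n))

countUpTo-suc : ∀ f n → countUpTo f (suc n) ≡ countUpTo f n + length (filterᵇ f (n ∷ []))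
countUpTo-suc f n = begin
  length (filterᵇ f (upTo (suc n)))                 ≡⟨ cong (length ∘ filterᵇ f) (upTo-∷ʳ n) ⟨
  length (filterᵇ f (upTo n ++ n ∷ []))             ≡⟨ cong length (filter-++ _ (upTo n) (n ∷ [])) ⟩
  length (filterᵇ f (upTo n) ++ filterᵇ f (n ∷ [])) ≡⟨ length-++ (filterᵇ f (upTo n)) ⟩
  countUpTo f n + length (filterᵇ f (n ∷ []))       ∎
  where open ≡-Reasoning

countUpTo-accept : ∀ f n → T (f n) → countUpTo f (suc n) ≡ suc (countUpTo f n)
countUpTo-accept f n fn = trans (countUpTo-suc f n)
  (trans (cong (λ xs → countUpTo f n + length xs) (filter-accept (T? ∘ f) {xs = []} fn)) (+-comm _ 1))

countUpTo-gap : ∀ f {a b} → a ≤ b → (∀ x → a ≤ x → x < b → ¬ T (f x)) →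
  countUpTo f b ≡ countUpTo f a
countUpTo-gap f {a} {zero}  z≤n _   = refl
countUpTo-gap f {a} {suc b} a≤b gap with m≤n⇒m<n∨m≡n a≤b
... | inj₂ refl       = refl
... | inj₁ (s≤s a≤b′) = begin
  countUpTo f (suc b)                         ≡⟨ countUpTo-suc f b ⟩
  countUpTo f b + length (filterᵇ f (b ∷ [])) ≡⟨ cong (λ xs → countUpTo f b + length xs)
                                                      (filter-reject (T? ∘ f) {xs = []} (gap b a≤b′ ≤-refl)) ⟩
  countUpTo f b + 0                           ≡⟨ +-identityʳ _ ⟩
  countUpTo f b                               ≡⟨ countUpTo-gap f a≤b′ (λ x a≤x x<b →
                                                   gap x a≤x (m<n⇒m<1+n x<b)) ⟩
  countUpTo f a                               ∎
  where open ≡-Reasoning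

ω-p*q : ∀ {p q} → Prime p → Prime q → p < q → ω (p * q) ≡ 2
ω-p*q {p} {q} pp pq p<q = begin
  countUpTo f (suc (p * q)) ≡⟨ countUpTo-gap f (s≤s (m≤n*m q p {{prime⇒nonZero pp}}))
                                 (onlyDivisors λ x q<x _ → <⇒≢ (<-trans p<q q<x) ∘ sym , <⇒≢ q<x ∘ sym) ⟩
  countUpTo f (suc q)       ≡⟨ countUpTo-accept f q (divisor pq (n∣m*n p)) ⟩
  suc (countUpTo f q)       ≡⟨ cong suc (countUpTo-gap f p<q
                                 (onlyDivisors λ x p<x x<q → <⇒≢ p<x ∘ sym , <⇒≢ x<q)) ⟩
  suc (countUpTo f (suc p)) ≡⟨ cong suc (countUpTo-accept f p (divisor pp (m∣m*n q))) ⟩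
  suc (suc (countUpTo f p)) ≡⟨ cong (suc ∘ suc) (countUpTo-gap f z≤n
                                 (onlyDivisors λ x _ x<p → <⇒≢ x<p , <⇒≢ (<-trans x<p p<q))) ⟩
  2                         ∎
  where
  open ≡-Reasoning
  f : ℕ → Bool
  f r = does (prime? r) ∧ does (r ∣? p * q)
  divisor : ∀ {r} → Prime r → r ∣ p * q → T (f r)
  divisor {r} pr r∣ =
    T-∧⁺ (subst T (sym (dec-true (prime? r) pr)) tt) (subst T (sym (dec-true (r ∣? p * q) r∣)) tt)
  onlyDivisors : ∀ {a b} → (∀ x → a ≤ x → x < b → x ≢ p × x ≢ q) →
    ∀ x → a ≤ x → x < b → ¬ T (f x)
  onlyDivisors other x a≤x x<b fx with prime? x | x ∣? p * q | other x a≤x x<b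
  ... | yes px | yes x∣ | x≢p , x≢q = [ x≢p , x≢q ]′ (prime∣p*q px pp pq x∣)

blue-p*q : ∀ {p q} → Prime p → Prime q → p < q → T (blueᵇ (p * q))
blue-p*q pp pq p<q = T-∧⁺ (squarefree-p*q pp pq (<⇒≢ p<q)) (subst (T ∘ evenᵇ) (sym (ω-p*q pp pq p<q)) tt)

blue⇒¬red : ∀ x → T (blueᵇ x) → ¬ T (redᵇ x)
blue⇒¬red x blue red with squarefreeᵇ x | evenᵇ (ω x)
... | true  | true  = red
... | true  | false = blue
... | false | _     = blue

BigBlue : ℕ → Set
BigBlue b = 3 ≤ b × T (blueᵇ b)

≤sum : ∀ xs → All (_≤ sum xs) xs
≤sum []       = []
≤sum (x ∷ xs) = m≤m+n x (sum xs) ∷ All.map (λ y≤ → ≤-trans y≤ (m≤n+m (sum xs) x)) (≤sum xs)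

bigBlueNumbers : ∀ K → ∃ λ bs → length bs ≡ K × AllPairs _>_ bs × All BigBlue bs
bigBlueNumbers zero = [] , refl , [] , []
bigBlueNumbers (suc K) with bs , len , dec , blue ← bigBlueNumbers K with p , pp , 2+Σ<p ← prime> (2 + sum bs) =
  2 * p ∷ bs , cong suc len ,
  All.map (λ b≤Σ → <-≤-trans (≤-<-trans b≤Σ Σ<p) p≤2p) (≤sum bs) ∷ dec ,
  (≤-trans 2<p p≤2p , blue-p*q prime[2] pp 2<p) ∷ blue
  where
  Σ<p : sum bs < p
  Σ<p = ≤-<-trans (m≤n+m (sum bs) 2) 2+Σ<p
  2<p : 2 < p
  2<p = ≤-<-trans (m≤m+n 2 (sum bs)) 2+Σ<p
  p≤2p : p ≤ 2 * p
  p≤2p = m≤n*m p 2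

isAdmissible-blue : ∀ {P} → Nonincreasing P → All BigBlue P → IsAdmissible (sum P) P
isAdmissible-blue {P} ni blue = record
  { nonincreasing = ni
  ; sum≡          = refl
  ; parts         = All.map part blue
  ; redOnce       = λ x red → subst (_≤ 1)
                      (sym (count-absent x (All.map (λ { (_ , by) refl → blue⇒¬red x by red }) blue))) z≤n
  }
  where
  part : ∀ {x} → BigBlue x → T (partᵇ x)
  part (3≤x , bx) = T-∧⁺ (≤⇒≤ᵇ (≤-trans (s≤s z≤n) 3≤x)) (Equivalence.from T-∨ (inj₁ bx))

replicate-++-injective : ∀ {b i i′ X X′} → All (_< b) X → All (_< b) X′ →
  replicate i b ++ X ≡ replicate i′ b ++ X′ → i ≡ i′ × X ≡ X′
replicate-++-injective {i = zero}  {zero}   _         _         eq = refl , eq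
replicate-++-injective {i = zero}  {suc _}  (x<b ∷ _) _         eq = ⊥-elim (<-irrefl (proj₁ (∷-injective eq)) x<b)
replicate-++-injective {i = suc _} {zero}   _         (x<b ∷ _) eq = ⊥-elim (<-irrefl (sym (proj₁ (∷-injective eq))) x<b)
replicate-++-injective {i = suc i} {suc i′} X<b       X′<b      eq =
  let i≡i′ , X≡X′ = replicate-++-injective {i = i} {i′} X<b X′<b (proj₂ (∷-injective eq))
  in cong suc i≡i′ , X≡X′

module _ (q : ℕ) where

  multiples : (bs : List ℕ) → Fin (q ^ length bs) → List ℕ
  multiplesOf : ∀ b bs → Fin q × Fin (q ^ length bs) → List ℕ

  multiples []       _ = []
  multiples (b ∷ bs) x = multiplesOf b bs (remQuot (q ^ length bs) x)

  multiplesOf b bs (i , y) = replicate (toℕ i) b ++ multiples bs y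

  multiples-All : ∀ {Q : ℕ → Set} bs x → All Q bs → All Q (multiples bs x)
  multiples-All []       _ []         = []
  multiples-All (b ∷ bs) x (qb ∷ qbs) = Allₚ.++⁺ (Allₚ.replicate⁺ _ qb) (multiples-All bs _ qbs)

  multiples-nonincreasing : ∀ bs x → AllPairs _>_ bs → Nonincreasing (multiples bs x)
  multiples-nonincreasing []       _ []         = []
  multiples-nonincreasing (b ∷ bs) x (b> ∷ dec) = AllPairsₚ.++⁺ (replicate-nonincreasing _ b)
    (multiples-nonincreasing bs _ dec) (Allₚ.replicate⁺ _ (All.map <⇒≤ (multiples-All bs _ b>)))

  multiples-sum : ∀ bs x → sum (multiples bs x) ≤ q * sum bs
  multiples-sum []       _ = z≤n
  multiples-sum (b ∷ bs) x = multiplesOf-sum (remQuot (q ^ length bs) x)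
    where
    multiplesOf-sum : ∀ iy → sum (multiplesOf b bs iy) ≤ q * (b + sum bs)
    multiplesOf-sum (i , y) = begin
      sum (replicate (toℕ i) b ++ multiples bs y)      ≡⟨ sum-++ (replicate (toℕ i) b) (multiples bs y) ⟩
      sum (replicate (toℕ i) b) + sum (multiples bs y) ≡⟨ cong (_+ _) (sum-replicate (toℕ i) b) ⟩
      toℕ i * b + sum (multiples bs y)                 ≤⟨ +-mono-≤ (*-monoˡ-≤ b (<⇒≤ (toℕ<n i)))
                                                                   (multiples-sum bs y) ⟩
      q * b + q * sum bs                               ≡⟨ *-distribˡ-+ q b (sum bs) ⟨
      q * (b + sum bs)                                 ∎
      where open ≤-Reasoning

  multiples-injective : ∀ bs → AllPairs _>_ bs → Injective _≡_ _≡_ (multiples bs)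
  multiples-injective []       _          {Fin.zero} {Fin.zero} _ = refl
  multiples-injective (b ∷ bs) (b> ∷ dec) {x} {x′} eq =
    let i≡i′ , rest≡ = replicate-++-injective (multiples-All bs _ b>) (multiples-All bs _ b>) eq
    in begin
      x                                                ≡⟨ combine-remQuot {q} (q ^ length bs) x ⟨
      uncurry combine (remQuot {q} (q ^ length bs) x)  ≡⟨ cong₂ (combine {q}) (toℕ-injective i≡i′)
                                                                (multiples-injective bs dec rest≡) ⟩
      uncurry combine (remQuot {q} (q ^ length bs) x′) ≡⟨ combine-remQuot {q} (q ^ length bs) x′ ⟩
      x′                                               ∎
    where open ≡-Reasoning

evenAdmissible-↣ : ∀ {n q bs} → AllPairs _>_ bs → All BigBlue bs → q * sum bs ≤ n →
  Fin (q ^ length bs) ↣ EvenAdmissible n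
evenAdmissible-↣ {n} {q} {bs} dec blue qΣ≤n =
  mk↣-via pad (bigParts ∘ proj₁) (multiples-injective q bs dec) (λ x → bigParts-++-smallParts 0 _ (big x))
  where
  P : Fin (q ^ length bs) → List ℕ
  P = multiples q bs
  blueP : ∀ x → All BigBlue (P x)
  blueP x = multiples-All q bs x blue
  big : ∀ x → AllBig (P x)
  big x = All.map proj₁ (blueP x)
  noRed : ∀ x → redParts (P x) ≡ 0
  noRed x = cong length (filter-none _ (All.map (λ {y} (_ , by) → blue⇒¬red y by) (blueP x)))
  isBig : ∀ x → T (bigᵇ (P x))
  isBig x = isBig⁻ (isAdmissible-blue (multiples-nonincreasing q bs x dec) (blueP x)) (big x)
  pad : Fin (q ^ length bs) → EvenAdmissible n
  pad x = P x ++ smallParts 0 (n ∸ sum (P x)) ,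
    T-∧⁺ (admissible-++-smallParts {P = P x} (isBig x) z≤n (m+[n∸m]≡n (≤-trans (multiples-sum q bs x) qΣ≤n)))
         (subst (T ∘ evenᵇ) (sym (trans (redParts-++-smallParts (P x) 0 _) (noRed x))) tt)

-- Asymptotics

[m*n]^k≡m^k*n^k : ∀ m n k → (m * n) ^ k ≡ m ^ k * n ^ k
[m*n]^k≡m^k*n^k m n zero    = refl
[m*n]^k≡m^k*n^k m n (suc k) =
  trans (cong (m * n *_) ([m*n]^k≡m^k*n^k m n k)) ([m*n]*[o*p]≡[m*o]*[n*p] m n (m ^ k) (n ^ k))

polynomial<exponential : ∀ M S .{{_ : NonZero S}} n → suc (M * (S + S) ^ (2 * M)) * S ≤ n →
  M * suc n ^ (2 * M) < (n / S) ^ suc (2 * M)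
polynomial<exponential M S n N≤n = begin-strict
  M * suc n ^ (2 * M)         ≤⟨ *-monoʳ-≤ M (^-monoˡ-≤ (2 * M) suc-n≤) ⟩
  M * (q * (S + S)) ^ (2 * M) ≡⟨ cong (M *_) ([m*n]^k≡m^k*n^k q (S + S) (2 * M)) ⟩
  M * (q ^ (2 * M) * a)       ≡⟨ cong (M *_) (*-comm (q ^ (2 * M)) a) ⟩
  M * (a * q ^ (2 * M))       ≡⟨ *-assoc M a (q ^ (2 * M)) ⟨
  M * a * q ^ (2 * M)         <⟨ *-monoˡ-< (q ^ (2 * M)) {{>-nonZero (m^n>0 q {{>-nonZero 0<q}} (2 * M))}} Ma<q ⟩
  q * q ^ (2 * M)             ∎
  where
  open ≤-Reasoning
  q = n / S
  a = (S + S) ^ (2 * M)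
  Ma<q : M * a < q
  Ma<q = subst (_≤ q) (m*n/n≡m (suc (M * a)) S) (/-monoˡ-≤ S N≤n)
  0<q : 0 < q
  0<q = ≤-<-trans z≤n Ma<q
  suc-n≤ : suc n ≤ q * (S + S)
  suc-n≤ = begin
    suc n         ≤⟨ subst (_< suc q * S) (sym (m≡m%n+[m/n]*n n S)) (+-monoˡ-< (q * S) (m%n<n n S)) ⟩
    suc q * S     ≤⟨ *-monoˡ-≤ S (+-monoˡ-≤ q 0<q) ⟩
    (q + q) * S   ≡⟨ *-distribʳ-+ S q q ⟩
    q * S + q * S ≡⟨ *-distribˡ-+ q S S ⟨
    q * (S + S)   ∎

[1+k]*d<e : ∀ k {d e o x} → suc (3 * suc k) * d ≤ e + o + x → o ≤ e + d → x < e → suc k * d < e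
[1+k]*d<e k {d} {e} {o} {x} Md≤ o≤ x<e =
  *-cancelˡ-< 3 (suc k * d) e (+-cancelˡ-< d (3 * (suc k * d)) (3 * e) (begin-strict
    d + 3 * (suc k * d) ≡⟨ expand k d ⟨
    suc (3 * suc k) * d ≤⟨ Md≤ ⟩
    e + o + x           ≤⟨ +-monoˡ-≤ x (+-monoʳ-≤ e o≤) ⟩
    e + (e + d) + x     <⟨ +-monoʳ-< (e + (e + d)) x<e ⟩
    e + (e + d) + e     ≡⟨ collect d e ⟩
    d + 3 * e           ∎))
  where
  open ≤-Reasoning
  expand : ∀ k d → suc (3 * suc k) * d ≡ d + 3 * (suc k * d)
  expand = solve-∀
  collect : ∀ d e → e + (e + d) + e ≡ d + 3 * e
  collect = solve-∀

sum-positive : ∀ {bs} → All BigBlue bs → 0 < length bs → 0 < sum bs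
sum-positive {b ∷ bs} ((3≤b , _) ∷ _) _ = ≤-trans (s≤s z≤n) (≤-trans 3≤b (m≤m+n b (sum bs)))

theorem1p1 : (E O : ℕ → ℕ)
    → (∀ n → Fin (E n) ↔ EvenAdmissible n)
    → (∀ n → Fin (O n) ↔ OddAdmissible n)
    → ∀ (k : ℕ) → ∃ λ N → ∀ n → N ≤ n → suc k * ∣ O n - E n ∣ < E n
theorem1p1 E O even odd k with bs , len , dec , blue ← bigBlueNumbers (suc (2 * suc (3 * suc k))) =
  suc (M * (S + S) ^ (2 * M)) * S , λ n N≤n →
    [1+k]*d<e k (M*∣O-E∣≤ n M (even n) (odd n)) (m≤n+∣m-n∣ (O n) (E n)) (<-≤-trans
      (polynomial<exponential M S n N≤n)
      (subst (λ K → (n / S) ^ K ≤ E n) len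
        (↣⇒≤ (↔⇒↣ (↔-sym (even n)) ↣-∘ evenAdmissible-↣ dec blue (m/n*n≤m n S)))))
  where
  M = suc (3 * suc k)
  S = sum bs
  instance
    S≢0 : NonZero S
    S≢0 = >-nonZero (sum-positive blue (subst (0 <_) (sym len) (s≤s z≤n)))
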